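{- For any real $\alpha>0$, every tripartite graph $G$ on $n$ vertices with more than $\frac{1+3\alpha}{12\alpha}n^2$ edges satisfies $\tau(G)<\alpha\,\nu(G)$. In particular, every tripartite graph $G$ on $n$ vertices with more than $\frac{33n^2}{112}$ edges satisfies $\tau(G)<\frac{28}{15}\nu(G)$.
   Context: A tripartite graph is a graph whose vertex set is partitioned into three independent sets. $\tau(G)$ is the minimum size of a set of edges whose removal leaves a triangle-free graph, and $\nu(G)$ is the maximum number of pairwise edge-disjoint triangles in $G$.
   Formalization: The parameter α ranges over the positive rationals instead of the positive reals. -}

module Defs where

open import Data.Nat using (ℕ; zero; suc; _<_)
open import Data.Fin using (Fin; toℕ)
open import Data.Bool using (Bool; true; false; T; not; _∧_; if_then_else_)
open import Data.List using (List; map; allFin)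
open import Data.Nat.ListAction using (sum)
open import Data.Product using (Σ; _×_; ∃; ∃-syntax)
open import Data.Sum using (_⊎_)
open import Relation.Nullary using (¬_)
open import Relation.Nullary.Decidable using (⌊_⌋)
open import Relation.Binary.PropositionalEquality using (_≡_; _≢_)
import Data.Nat as ℕ

record Graph (n : ℕ) : Set where
  field
    adj   : Fin n → Fin n → Bool
    sym   : ∀ i j → adj i j ≡ adj j i
    irrefl : ∀ i → adj i i ≡ false
open Graph public

Tripartite : ∀ {n} → Graph n → Set
Tripartite {n} G = Σ (Fin n → Fin 3) λ c → ∀ i j → T (adj G i j) → c i ≢ c j

countPairs : ∀ {n} → (Fin n → Fin n → Bool) → ℕ
countPairs {n} f =
  sum (map (λ i → sum (map (λ j → if f i j ∧ ⌊ toℕ i ℕ.<? toℕ j ⌋ then 1 else 0)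
                           (allFin n)))
           (allFin n))

edges : ∀ {n} → Graph n → ℕ
edges G = countPairs (adj G)

record EdgeSubset {n} (G : Graph n) : Set where
  field
    inF    : Fin n → Fin n → Bool
    symF   : ∀ i j → inF i j ≡ inF j i
    subset : ∀ i j → T (inF i j) → T (adj G i j)
open EdgeSubset public

size : ∀ {n} {G : Graph n} → EdgeSubset G → ℕ
size F = countPairs (inF F)

remAdj : ∀ {n} {G : Graph n} → EdgeSubset G → Fin n → Fin n → Bool
remAdj {G = G} F i j = adj G i j ∧ not (inF F i j)

TriangleFree : ∀ {n} → (Fin n → Fin n → Bool) → Set
TriangleFree {n} a = ∀ (x y z : Fin n) → ¬ (T (a x y) × T (a y z) × T (a x z))

IsCover : ∀ {n} {G : Graph n} → EdgeSubset G → Set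
IsCover F = TriangleFree (remAdj F)

IsTau : ∀ {n} → Graph n → ℕ → Set
IsTau G t = (Σ (EdgeSubset G) λ F → IsCover F × size F ≡ t)
          × (∀ (F : EdgeSubset G) → IsCover F → t ℕ.≤ size F)

record Triangle {n} (G : Graph n) : Set where
  field
    v₁ v₂ v₃ : Fin n
    e₁₂ : T (adj G v₁ v₂)
    e₂₃ : T (adj G v₂ v₃)
    e₁₃ : T (adj G v₁ v₃)
open Triangle public

_∈▵_ : ∀ {n} {G : Graph n} → Fin n → Triangle G → Set
u ∈▵ t = (u ≡ v₁ t) ⊎ (u ≡ v₂ t) ⊎ (u ≡ v₃ t)

ShareEdge : ∀ {n} {G : Graph n} → Triangle G → Triangle G → Set
ShareEdge {n} s t = ∃[ u ] ∃[ v ] (u ≢ v × u ∈▵ s × v ∈▵ s × u ∈▵ t × v ∈▵ t)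

Packing : ∀ {n} → Graph n → ℕ → Set
Packing G k = Σ (Fin k → Triangle G) λ P → ∀ a b → a ≢ b → ¬ ShareEdge (P a) (P b)

IsNu : ∀ {n} → Graph n → ℕ → Set
IsNu G k = Packing G k × (∀ m → Packing G m → m ℕ.≤ k)

-- Order the colour classes A, B, C of G so that C is the largest. Deleting the A–B edges
-- leaves every triangle with an edge missing, so τ ≤ |A||B|. Conversely, the triangles
-- {aᵢ, bⱼ, c₍ᵢ₊ⱼ₎ mod |C|} whose three edges are present are pairwise edge-disjoint,
-- because (i, j) ↦ i + j mod |C| is a Latin rectangle, and each non-adjacent pair of
-- vertices in different classes spoils at most one of them; hence ν ≥ |A||B| − m, where m
-- counts such pairs. Now e + m = |A||B| + |A||C| + |B||C|, and the inequalities
-- 3(|A||B| + |A||C| + |B||C|) ≤ n² and 4(|A| + |B|)|C| ≤ n² turn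
-- e > (1 + 3α) n² / (12α) into τ < αν. For α = p/q everything is an inequality between
-- natural numbers; the rational statement follows by clearing the denominator.

module Submission where

open import Defs renaming (sym to adj-sym)

module Counting where

  open import Data.Nat using (ℕ; zero; suc; _+_; _*_; _∸_; _≤_; _<_; z≤n; s≤s; _<?_; NonZero)
  open import Data.Nat.Properties hiding (_≟_)
  open import Data.Nat.DivMod using (_%_; _/_; _mod_; %-distribˡ-+; m%n%n≡m%n; m≡m%n+[m/n]*n; [m+kn]%n≡m%n; m<n⇒m%n≡m; m%n≤n)
  open import Data.Nat.ListAction using (sum)
  open import Data.Nat.ListAction.Properties using (sum-++)
  open import Data.Nat.Tactic.RingSolver using (solve-∀)
  open import Data.Fin using (Fin; toℕ; punchIn; punchOut; _≟_) renaming (zero to fzero; suc to fsuc)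
  open import Data.Fin.Patterns using (0F; 1F; 2F)
  import Data.Fin.Properties as Finₚ
  open import Data.Fin.Permutation using (Permutation; _⟨$⟩ʳ_; _⟨$⟩ˡ_; inverseˡ; inverseʳ; transpose)
  open import Data.Bool using (Bool; true; false; T; not; _∧_; _∨_; if_then_else_)
  open import Data.Bool.Properties using (T-∧; T-∨; ∨-comm; ∧-zeroʳ)
  open import Data.List using (List; []; _∷_; _++_; map; length; lookup; tabulate; filter; allFin; cartesianProduct)
  open import Data.List.Properties using (map-++; map-∘; filter-≐)
  open import Data.List.Membership.Propositional.Properties using (∈-lookup)
  import Data.List.Relation.Unary.All as All
  open import Data.List.Relation.Unary.All.Properties using (all-filter)
  open import Data.List.Relation.Unary.AllPairs using (_∷_)
  open import Data.List.Relation.Unary.Unique.Propositional using (Unique)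
  import Data.List.Relation.Unary.Unique.Propositional.Properties as Uniqueₚ
  open import Data.Product using (Σ-syntax; _×_; _,_; proj₁; proj₂; map₂)
  open import Data.Sum as Sum using (_⊎_; inj₁; inj₂)
  open import Data.Empty using (⊥-elim)
  open import Data.Unit using (tt)
  open import Function using (_∘_; Injective)
  open import Function.Bundles using (Equivalence)
  open import Relation.Nullary using (¬_; does; yes; no)
  open import Relation.Nullary.Decidable using (⌊_⌋; toWitness; fromWitness; T?)
  open import Relation.Unary using (Decidable)
  open import Relation.Binary.PropositionalEquality
  open import Algebra.Properties.CommutativeMonoid.Sum +-0-commutativeMonoid
    using (sum-syntax; sum-cong-≗; sum-replicate-zero; sum-remove; ∑-distrib-+; ∑-comm)

  -- Written with if_then_else_ so that it unfolds to the summand of countPairs.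
  𝟙 : Bool → ℕ
  𝟙 b = if b then 1 else 0

  𝟙+𝟙-not : ∀ b → 𝟙 b + 𝟙 (not b) ≡ 1
  𝟙+𝟙-not true  = refl
  𝟙+𝟙-not false = refl

  𝟙≤1 : ∀ b → 𝟙 b ≤ 1
  𝟙≤1 true  = ≤-refl
  𝟙≤1 false = z≤n

  1≤𝟙∧+𝟙-not : ∀ u v w → 1 ≤ 𝟙 (u ∧ v ∧ w) + (𝟙 (not u) + 𝟙 (not w) + 𝟙 (not v))
  1≤𝟙∧+𝟙-not true  true  true  = s≤s z≤n
  1≤𝟙∧+𝟙-not true  true  false = s≤s z≤n
  1≤𝟙∧+𝟙-not true  false true  = s≤s z≤n
  1≤𝟙∧+𝟙-not true  false false = s≤s z≤n
  1≤𝟙∧+𝟙-not false v     w     = s≤s z≤n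

  T-∧-not-∧-not : ∀ a m → T (a ∧ not (a ∧ not m)) → T a × T m
  T-∧-not-∧-not true true _ = tt , tt

  ∧-not-T : ∀ a {m} → T m → a ∧ not m ≡ false
  ∧-not-T a {true} _ = ∧-zeroʳ a

  ∑-const : ∀ n x → ∑[ i < n ] x ≡ n * x
  ∑-const zero    x = refl
  ∑-const (suc n) x = cong (x +_) (∑-const n x)

  ∑-mono-≤ : ∀ {n} {f g : Fin n → ℕ} → (∀ i → f i ≤ g i) → ∑[ i < n ] f i ≤ ∑[ i < n ] g i
  ∑-mono-≤ {zero}  f≤g = z≤n
  ∑-mono-≤ {suc n} f≤g = +-mono-≤ (f≤g fzero) (∑-mono-≤ (f≤g ∘ fsuc))

  -- Remove h 0 from the range: the other values of h avoid it, so punching it out leaves an injection.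
  ∑-injective-≤ : ∀ {b d} (g : Fin d → ℕ) {h : Fin b → Fin d} → Injective _≡_ _≡_ h →
                  ∑[ j < b ] g (h j) ≤ ∑[ r < d ] g r
  ∑-injective-≤ {zero}           g         h-inj = z≤n
  ∑-injective-≤ {suc b} {zero}  g {h}     h-inj with () ← h fzero
  ∑-injective-≤ {suc b} {suc d} g {h} h-inj = begin
    g r₀ + ∑[ j < b ] g (h (fsuc j))                      ≡⟨ cong (g r₀ +_) (sum-cong-≗ (λ j → cong g (sym (Finₚ.punchIn-punchOut (avoids j))))) ⟩
    g r₀ + ∑[ j < b ] g (punchIn r₀ (h′ j))               ≤⟨ +-monoʳ-≤ (g r₀) (∑-injective-≤ (g ∘ punchIn r₀) h′-inj) ⟩
    g r₀ + ∑[ r < d ] g (punchIn r₀ r)                    ≡⟨ sum-remove {i = r₀} g ⟨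
    ∑[ r < suc d ] g r                                    ∎
    where
    open ≤-Reasoning
    r₀ = h fzero
    avoids : ∀ j → r₀ ≢ h (fsuc j)
    avoids j = (λ ()) ∘ h-inj
    h′ : Fin b → Fin d
    h′ j = punchOut (avoids j)
    h′-inj : Injective _≡_ _≡_ h′
    h′-inj {i} {j} eq = Finₚ.suc-injective (h-inj (Finₚ.punchOut-injective (avoids i) (avoids j) eq))

  ∑∑-distrib-+ : ∀ {m n} (f g : Fin m → Fin n → ℕ) →
    ∑[ i < m ] ∑[ j < n ] (f i j + g i j) ≡ ∑[ i < m ] ∑[ j < n ] f i j + ∑[ i < m ] ∑[ j < n ] g i j
  ∑∑-distrib-+ {n = n} f g =
    trans (sum-cong-≗ λ i → ∑-distrib-+ (f i) (g i)) (∑-distrib-+ (λ i → ∑[ j < n ] f i j) (λ i → ∑[ j < n ] g i j))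

  ∑-indicator : ∀ {k} (t : Fin k) (y : ℕ) → ∑[ s < k ] (if does (t ≟ s) then y else 0) ≡ y
  ∑-indicator {suc k} fzero    y = trans (cong (y +_) (sum-replicate-zero k)) (+-identityʳ y)
  ∑-indicator {suc k} (fsuc t) y = ∑-indicator t y

  ∑-symmetric-hollow : ∀ (B : Fin 3 → Fin 3 → ℕ) → (∀ s → B s s ≡ 0) → (∀ s t → B t s ≡ B s t) →
                       ∑[ s < 3 ] ∑[ t < 3 ] B s t ≡ 2 * (B 0F 1F + B 0F 2F + B 1F 2F)
  ∑-symmetric-hollow B hollow symmetric
    rewrite hollow 0F | hollow 1F | hollow 2F | symmetric 0F 1F | symmetric 0F 2F | symmetric 1F 2F =
    nine-terms (B 0F 1F) (B 0F 2F) (B 1F 2F)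
    where
    nine-terms : ∀ a b c → (0 + (a + (b + 0))) + ((a + (0 + (c + 0))) + ((b + (c + (0 + 0))) + 0)) ≡ 2 * (a + b + c)
    nine-terms = solve-∀

  module _ {A : Set} where

    sum-map-tabulate : ∀ {n} (f : A → ℕ) (g : Fin n → A) → sum (map f (tabulate g)) ≡ ∑[ i < n ] f (g i)
    sum-map-tabulate {zero}  f g = refl
    sum-map-tabulate {suc n} f g = cong (f (g fzero) +_) (sum-map-tabulate f (g ∘ fsuc))

    sum-map-lookup : ∀ (f : A → ℕ) xs → sum (map f xs) ≡ ∑[ i < length xs ] f (lookup xs i)
    sum-map-lookup f []       = refl
    sum-map-lookup f (x ∷ xs) = cong (f x +_) (sum-map-lookup f xs)

    sum-map-cartesianProduct : ∀ {B : Set} (h : A × B → ℕ) xs ys →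
      sum (map h (cartesianProduct xs ys)) ≡ sum (map (λ x → sum (map (λ y → h (x , y)) ys)) xs)
    sum-map-cartesianProduct h []       ys = refl
    sum-map-cartesianProduct h (x ∷ xs) ys = begin
      sum (map h (map (x ,_) ys ++ cartesianProduct xs ys))               ≡⟨ cong sum (map-++ h (map (x ,_) ys) (cartesianProduct xs ys)) ⟩
      sum (map h (map (x ,_) ys) ++ map h (cartesianProduct xs ys))       ≡⟨ sum-++ (map h (map (x ,_) ys)) _ ⟩
      sum (map h (map (x ,_) ys)) + sum (map h (cartesianProduct xs ys))  ≡⟨ cong₂ _+_ (cong sum (sym (map-∘ ys))) (sum-map-cartesianProduct h xs ys) ⟩
      sum (map (λ y → h (x , y)) ys) + sum (map (λ x → sum (map (λ y → h (x , y)) ys)) xs) ∎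
      where open ≡-Reasoning

    length-filter≡sum : ∀ {P : A → Set} (P? : Decidable P) xs → length (filter P? xs) ≡ sum (map (𝟙 ∘ does ∘ P?) xs)
    length-filter≡sum P? []       = refl
    length-filter≡sum P? (x ∷ xs) with does (P? x)
    ... | true  = cong suc (length-filter≡sum P? xs)
    ... | false = length-filter≡sum P? xs

    lookup-injective : ∀ {xs : List A} → Unique xs → Injective _≡_ _≡_ (lookup xs)
    lookup-injective (x∉xs ∷ _)  {fzero}  {fzero}  _  = refl
    lookup-injective (x∉xs ∷ _)  {fzero}  {fsuc j} eq = ⊥-elim (All.lookup x∉xs (∈-lookup j) eq)
    lookup-injective (x∉xs ∷ _)  {fsuc i} {fzero}  eq = ⊥-elim (All.lookup x∉xs (∈-lookup i) (sym eq))
    lookup-injective (_    ∷ xs) {fsuc i} {fsuc j} eq = cong fsuc (lookup-injective xs eq)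

  sum-map-allFin : ∀ {n} (f : Fin n → ℕ) → sum (map f (allFin n)) ≡ ∑[ i < n ] f i
  sum-map-allFin f = sum-map-tabulate f (λ i → i)

  _<ᵇ_ : ∀ {n} → Fin n → Fin n → Bool
  i <ᵇ j = ⌊ toℕ i <? toℕ j ⌋

  split-by-order : ∀ {n} (b : Bool) (i j : Fin n) → (i ≡ j → b ≡ false) →
                   𝟙 (b ∧ i <ᵇ j) + 𝟙 (b ∧ j <ᵇ i) ≡ 𝟙 b
  split-by-order false i j _ = refl
  split-by-order true  i j irr with toℕ i <? toℕ j | toℕ j <? toℕ i
  ... | yes i<j | yes j<i = ⊥-elim (<-asym i<j j<i)
  ... | yes _   | no  _   = refl
  ... | no  _   | yes _   = refl
  ... | no  i≮j | no  j≮i with () ← irr (Finₚ.toℕ-injective (≤-antisym (≮⇒≥ j≮i) (≮⇒≥ i≮j)))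

  countPairs-double : ∀ {n} (f : Fin n → Fin n → Bool) → (∀ i j → f i j ≡ f j i) → (∀ i → f i i ≡ false) →
                      2 * countPairs f ≡ ∑[ i < n ] ∑[ j < n ] 𝟙 (f i j)
  countPairs-double {n} f f-sym f-irr = begin
    2 * countPairs f                                                 ≡⟨ cong₂ _+_ below (trans (+-identityʳ _) above) ⟩
    ∑[ i < n ] ∑[ j < n ] 𝟙 (f i j ∧ i <ᵇ j) + ∑[ i < n ] ∑[ j < n ] 𝟙 (f i j ∧ j <ᵇ i)
                                                                     ≡⟨ ∑∑-distrib-+ (λ i j → 𝟙 (f i j ∧ i <ᵇ j)) (λ i j → 𝟙 (f i j ∧ j <ᵇ i)) ⟨
    ∑[ i < n ] ∑[ j < n ] (𝟙 (f i j ∧ i <ᵇ j) + 𝟙 (f i j ∧ j <ᵇ i)) ≡⟨ sum-cong-≗ (λ i → sum-cong-≗ λ j → split-by-order (f i j) i j λ { refl → f-irr i }) ⟩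
    ∑[ i < n ] ∑[ j < n ] 𝟙 (f i j)                                  ∎
    where
    open ≡-Reasoning
    below : countPairs f ≡ ∑[ i < n ] ∑[ j < n ] 𝟙 (f i j ∧ i <ᵇ j)
    below = trans (sum-map-allFin λ i → sum (map (λ j → 𝟙 (f i j ∧ i <ᵇ j)) (allFin n)))
                  (sum-cong-≗ λ i → sum-map-allFin λ j → 𝟙 (f i j ∧ i <ᵇ j))
    above : countPairs f ≡ ∑[ i < n ] ∑[ j < n ] 𝟙 (f i j ∧ j <ᵇ i)
    above = trans below (trans (∑-comm (λ i j → 𝟙 (f i j ∧ i <ᵇ j)))
                               (sum-cong-≗ λ i → sum-cong-≗ λ j → cong (λ b → 𝟙 (b ∧ j <ᵇ i)) (f-sym j i)))

  -- Latin rectangles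

  -- Adding d ∸ m % d undoes adding m, modulo d.
  +-%-cancelˡ : ∀ m {d x y} .{{_ : NonZero d}} → x < d → y < d → (m + x) % d ≡ (m + y) % d → x ≡ y
  +-%-cancelˡ m {d} x<d y<d eq = trans (sym (undo _ x<d)) (trans (cong (λ w → (w + k) % d) eq) (undo _ y<d))
    where
    open ≡-Reasoning
    k = d ∸ m % d
    shift : ∀ z → m + z + k ≡ z + suc (m / d) * d
    shift z = begin
      m + z + k                        ≡⟨ cong (λ w → w + z + k) (m≡m%n+[m/n]*n m d) ⟩
      m % d + m / d * d + z + k        ≡⟨ rearrange (m % d) (m / d * d) z k ⟩
      z + ((m % d + k) + m / d * d)    ≡⟨ cong (λ w → z + (w + m / d * d)) (m+[n∸m]≡n (m%n≤n m d)) ⟩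
      z + suc (m / d) * d              ∎
      where
      rearrange : ∀ r q z k → r + q + z + k ≡ z + ((r + k) + q)
      rearrange = solve-∀
    undo : ∀ z → z < d → ((m + z) % d + k) % d ≡ z
    undo z z<d = begin
      ((m + z) % d + k) % d            ≡⟨ %-distribˡ-+ ((m + z) % d) k d ⟩
      ((m + z) % d % d + k % d) % d    ≡⟨ cong (λ w → (w + k % d) % d) (m%n%n≡m%n (m + z) d) ⟩
      ((m + z) % d + k % d) % d        ≡⟨ %-distribˡ-+ (m + z) k d ⟨
      (m + z + k) % d                  ≡⟨ cong (_% d) (shift z) ⟩
      (z + suc (m / d) * d) % d        ≡⟨ [m+kn]%n≡m%n z (suc (m / d)) d ⟩
      z % d                            ≡⟨ m<n⇒m%n≡m z<d ⟩
      z                                ∎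

  LatinRectangle : ℕ → ℕ → ℕ → Set
  LatinRectangle a b d =
    Σ[ σ ∈ (Fin a → Fin b → Fin d) ] (∀ i → Injective _≡_ _≡_ (σ i)) × (∀ j → Injective _≡_ _≡_ (λ i → σ i j))

  latinRectangle : ∀ {a b d} → a ≤ d → b ≤ d → LatinRectangle a b d
  latinRectangle {zero}          _   _   = (λ ()) , (λ ()) , λ { _ {()} }
  latinRectangle {suc a} {d = suc d} a≤d b≤d = σ , σ-injʳ , σ-injˡ
    where
    σ : Fin (suc a) → Fin _ → Fin (suc d)
    σ i j = (toℕ i + toℕ j) mod suc d
    toℕ-σ : ∀ i j → toℕ (σ i j) ≡ (toℕ i + toℕ j) % suc d
    toℕ-σ i j = Finₚ.toℕ-fromℕ< _
    σ-injʳ : ∀ i → Injective _≡_ _≡_ (σ i)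
    σ-injʳ i {j} {j′} eq = Finₚ.toℕ-injective (+-%-cancelˡ (toℕ i)
      (<-≤-trans (Finₚ.toℕ<n j) b≤d) (<-≤-trans (Finₚ.toℕ<n j′) b≤d)
      (trans (sym (toℕ-σ i j)) (trans (cong toℕ eq) (toℕ-σ i j′))))
    σ-injˡ : ∀ j → Injective _≡_ _≡_ (λ i → σ i j)
    σ-injˡ j {i} {i′} eq = Finₚ.toℕ-injective (+-%-cancelˡ (toℕ j)
      (<-≤-trans (Finₚ.toℕ<n i) a≤d) (<-≤-trans (Finₚ.toℕ<n i′) a≤d)
      (trans (cong (_% suc d) (+-comm (toℕ j) (toℕ i)))
      (trans (sym (toℕ-σ i j)) (trans (cong toℕ eq) (trans (toℕ-σ i′ j) (cong (_% suc d) (+-comm (toℕ i′) (toℕ j))))))))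

  Proper : ∀ {n k} → Graph n → (Fin n → Fin k) → Set
  Proper G c = ∀ i j → T (adj G i j) → c i ≢ c j

  class : ∀ {n k} → (Fin n → Fin k) → Fin k → List (Fin n)
  class {n} c s = filter (λ x → c x ≟ s) (allFin n)

  classSize : ∀ {n k} → (Fin n → Fin k) → Fin k → ℕ
  classSize c s = length (class c s)

  module ColourClasses {n k : ℕ} (c : Fin n → Fin k) where

    ∣_∣ : Fin k → ℕ
    ∣ s ∣ = classSize c s

    member : (s : Fin k) → Fin ∣ s ∣ → Fin n
    member s = lookup (class c s)

    colour-member : ∀ s i → c (member s i) ≡ s
    colour-member s i = All.lookup (all-filter (λ x → c x ≟ s) (allFin n)) (∈-lookup i)

    member-injective : ∀ s → Injective _≡_ _≡_ (member s)
    member-injective s = lookup-injective (Uniqueₚ.filter⁺ (λ x → c x ≟ s) (Uniqueₚ.allFin⁺ n))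

    sum-by-class : ∀ (f : Fin n → ℕ) xs → sum (map f xs) ≡ ∑[ s < k ] sum (map f (filter (λ x → c x ≟ s) xs))
    sum-by-class f []       = sym (sum-replicate-zero k)
    sum-by-class f (x ∷ xs) = begin
      f x + sum (map f xs)                                               ≡⟨ cong₂ _+_ (∑-indicator (c x) (f x)) (sym (sum-by-class f xs)) ⟨
      ∑[ s < k ] (if does (c x ≟ s) then f x else 0) + ∑[ s < k ] rest s ≡⟨ ∑-distrib-+ (λ s → if does (c x ≟ s) then f x else 0) rest ⟨
      ∑[ s < k ] ((if does (c x ≟ s) then f x else 0) + rest s)          ≡⟨ sum-cong-≗ step ⟩
      ∑[ s < k ] sum (map f (filter (λ y → c y ≟ s) (x ∷ xs)))           ∎
      where
      open ≡-Reasoning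
      rest : Fin k → ℕ
      rest s = sum (map f (filter (λ y → c y ≟ s) xs))
      step : ∀ s → (if does (c x ≟ s) then f x else 0) + rest s ≡ sum (map f (filter (λ y → c y ≟ s) (x ∷ xs)))
      step s with does (c x ≟ s)
      ... | true  = refl
      ... | false = refl

    ∑-by-class : ∀ (f : Fin n → ℕ) → ∑[ x < n ] f x ≡ ∑[ s < k ] ∑[ i < ∣ s ∣ ] f (member s i)
    ∑-by-class f = trans (sym (sum-map-allFin f))
                         (trans (sum-by-class f (allFin n)) (sum-cong-≗ λ s → sum-map-lookup f (class c s)))

    block : Fin k → Fin k → (Fin n → Fin n → ℕ) → ℕ
    block s t g = ∑[ i < ∣ s ∣ ] ∑[ j < ∣ t ∣ ] g (member s i) (member t j)

    ∑∑-by-blocks : ∀ g → ∑[ x < n ] ∑[ y < n ] g x y ≡ ∑[ s < k ] ∑[ t < k ] block s t g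
    ∑∑-by-blocks g = begin
      ∑[ x < n ] ∑[ y < n ] g x y
        ≡⟨ ∑-by-class (λ x → ∑[ y < n ] g x y) ⟩
      ∑[ s < k ] ∑[ i < ∣ s ∣ ] ∑[ y < n ] g (member s i) y
        ≡⟨ sum-cong-≗ (λ s → sum-cong-≗ λ i → ∑-by-class (g (member s i))) ⟩
      ∑[ s < k ] ∑[ i < ∣ s ∣ ] ∑[ t < k ] ∑[ j < ∣ t ∣ ] g (member s i) (member t j)
        ≡⟨ sum-cong-≗ (λ s → ∑-comm (λ i t → ∑[ j < ∣ t ∣ ] g (member s i) (member t j))) ⟩
      ∑[ s < k ] ∑[ t < k ] block s t g ∎
      where open ≡-Reasoning

    n≡∑∣class∣ : n ≡ ∑[ s < k ] ∣ s ∣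
    n≡∑∣class∣ = begin
      n                                ≡⟨ *-identityʳ n ⟨
      n * 1                            ≡⟨ ∑-const n 1 ⟨
      ∑[ x < n ] 1                     ≡⟨ ∑-by-class (λ _ → 1) ⟩
      ∑[ s < k ] ∑[ i < ∣ s ∣ ] 1      ≡⟨ sum-cong-≗ (λ s → trans (∑-const ∣ s ∣ 1) (*-identityʳ ∣ s ∣)) ⟩
      ∑[ s < k ] ∣ s ∣                 ∎
      where open ≡-Reasoning

    block-ones : ∀ s t → block s t (λ _ _ → 1) ≡ ∣ s ∣ * ∣ t ∣
    block-ones s t = trans (sum-cong-≗ {∣ s ∣} λ _ → trans (∑-const ∣ t ∣ 1) (*-identityʳ ∣ t ∣)) (∑-const ∣ s ∣ ∣ t ∣)

    block-≤ : ∀ s t g → (∀ x y → g x y ≤ 1) → block s t g ≤ ∣ s ∣ * ∣ t ∣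
    block-≤ s t g g≤1 = ≤-trans (∑-mono-≤ λ i → ∑-mono-≤ λ j → g≤1 (member s i) (member t j)) (≤-reflexive (block-ones s t))

    block-complement : ∀ s t g h → (∀ x y → g x y + h x y ≡ 1) → block s t g + block s t h ≡ ∣ s ∣ * ∣ t ∣
    block-complement s t g h g+h≡1 = begin
      block s t g + block s t h                                                      ≡⟨ ∑∑-distrib-+ G′ H′ ⟨
      ∑[ i < ∣ s ∣ ] ∑[ j < ∣ t ∣ ] (G′ i j + H′ i j)                                 ≡⟨ sum-cong-≗ (λ i → sum-cong-≗ λ j → g+h≡1 (member s i) (member t j)) ⟩
      block s t (λ _ _ → 1)                                                          ≡⟨ block-ones s t ⟩
      ∣ s ∣ * ∣ t ∣                                                                  ∎
      where
      open ≡-Reasoning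
      G′ H′ : Fin ∣ s ∣ → Fin ∣ t ∣ → ℕ
      G′ i j = g (member s i) (member t j)
      H′ i j = h (member s i) (member t j)

    block-transpose : ∀ s t g → block t s g ≡ block s t (λ x y → g y x)
    block-transpose s t g = ∑-comm (λ i j → g (member t i) (member s j))

    block-zero : ∀ s t g → (∀ x y → c x ≡ s → c y ≡ t → g x y ≡ 0) → block s t g ≡ 0
    block-zero s t g g≡0 =
      trans (sum-cong-≗ λ i → trans (sum-cong-≗ λ j → g≡0 (member s i) (member t j) (colour-member s i) (colour-member t j))
                                    (sum-replicate-zero ∣ t ∣))
            (sum-replicate-zero ∣ s ∣)

  -- A triangle cover and a triangle packing

  module Tripartition {n} (G : Graph n) (c : Fin n → Fin 3) (proper : Proper G c) where
    open ColourClasses c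

    adj-same-colour : ∀ {x y} → c x ≡ c y → adj G x y ≡ false
    adj-same-colour {x} {y} cx≡cy with adj G x y in eq
    ... | false = refl
    ... | true  = ⊥-elim (proper x y (subst T (sym eq) tt) cx≡cy)

    ∑∑-cross-blocks : ∀ g → (∀ x y → g x y ≡ g y x) → (∀ x y → c x ≡ c y → g x y ≡ 0) →
                      ∑[ x < n ] ∑[ y < n ] g x y ≡ 2 * (block 0F 1F g + block 0F 2F g + block 1F 2F g)
    ∑∑-cross-blocks g g-sym g-same = trans (∑∑-by-blocks g) (∑-symmetric-hollow (λ s t → block s t g) hollow symmetric)
      where
      hollow : ∀ s → block s s g ≡ 0
      hollow s = block-zero s s g λ x y cx≡s cy≡s → g-same x y (trans cx≡s (sym cy≡s))
      symmetric : ∀ s t → block t s g ≡ block s t g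
      symmetric s t = trans (block-transpose s t g) (sum-cong-≗ λ i → sum-cong-≗ λ j → g-sym (member t j) (member s i))

    E M : Fin 3 → Fin 3 → ℕ
    E s t = block s t (λ x y → 𝟙 (adj G x y))
    M s t = block s t (λ x y → 𝟙 (not (adj G x y)))

    edges≡ : edges G ≡ E 0F 1F + E 0F 2F + E 1F 2F
    edges≡ = *-cancelˡ-≡ _ _ 2 (trans (countPairs-double (adj G) (adj-sym G) (irrefl G))
                                      (∑∑-cross-blocks (λ x y → 𝟙 (adj G x y)) (λ x y → cong 𝟙 (adj-sym G x y)) (λ x y → cong 𝟙 ∘ adj-same-colour)))

    E+M≡ : ∀ s t → E s t + M s t ≡ ∣ s ∣ * ∣ t ∣
    E+M≡ s t = block-complement s t (λ x y → 𝟙 (adj G x y)) (λ x y → 𝟙 (not (adj G x y))) λ x y → 𝟙+𝟙-not (adj G x y)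

    edges+missing : edges G + (M 0F 1F + M 0F 2F + M 1F 2F) ≡ ∣ 0F ∣ * ∣ 1F ∣ + (∣ 0F ∣ * ∣ 2F ∣ + ∣ 1F ∣ * ∣ 2F ∣)
    edges+missing = begin
      edges G + (M 0F 1F + M 0F 2F + M 1F 2F)
        ≡⟨ cong (_+ (M 0F 1F + M 0F 2F + M 1F 2F)) edges≡ ⟩
      E 0F 1F + E 0F 2F + E 1F 2F + (M 0F 1F + M 0F 2F + M 1F 2F)
        ≡⟨ interchange (E 0F 1F) (E 0F 2F) (E 1F 2F) (M 0F 1F) (M 0F 2F) (M 1F 2F) ⟩
      (E 0F 1F + M 0F 1F) + ((E 0F 2F + M 0F 2F) + (E 1F 2F + M 1F 2F))
        ≡⟨ cong₂ _+_ (E+M≡ 0F 1F) (cong₂ _+_ (E+M≡ 0F 2F) (E+M≡ 1F 2F)) ⟩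
      ∣ 0F ∣ * ∣ 1F ∣ + (∣ 0F ∣ * ∣ 2F ∣ + ∣ 1F ∣ * ∣ 2F ∣) ∎
      where
      open ≡-Reasoning
      interchange : ∀ a b c d e f → a + b + c + (d + e + f) ≡ (a + d) + ((b + e) + (c + f))
      interchange = solve-∀

    meets : Fin 3 → Fin n → Fin n → Bool
    meets u x y = ⌊ c x ≟ u ⌋ ∨ ⌊ c y ≟ u ⌋

    meets⇒ : ∀ u {x y} → T (meets u x y) → c x ≡ u ⊎ c y ≡ u
    meets⇒ u {x} {y} = Sum.map (toWitness {a? = c x ≟ u}) (toWitness {a? = c y ≟ u}) ∘ Equivalence.to T-∨

    avoiding : Fin 3 → EdgeSubset G
    avoiding u = record
      { inF    = λ x y → adj G x y ∧ not (meets u x y)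
      ; symF   = λ x y → cong₂ (λ a m → a ∧ not m) (adj-sym G x y) (∨-comm ⌊ c x ≟ u ⌋ ⌊ c y ≟ u ⌋)
      ; subset = λ x y → proj₁ ∘ Equivalence.to T-∧
      }

    remaining-meets : ∀ u {v w} → T (remAdj (avoiding u) v w) → T (adj G v w) × (c v ≡ u ⊎ c w ≡ u)
    remaining-meets u {v} {w} = map₂ (meets⇒ u) ∘ T-∧-not-∧-not (adj G v w) (meets u v w)

    -- Every remaining edge meets class u, whereas a triangle has at most one vertex there.
    avoiding-isCover : ∀ u → IsCover (avoiding u)
    avoiding-isCover u x y z (xy , yz , xz) with remaining-meets u xy | remaining-meets u yz | remaining-meets u xz
    ... | x~y , inj₁ x∈u | _ , inj₁ y∈u | _         = proper x y x~y (trans x∈u (sym y∈u))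
    ... | _   , inj₁ x∈u | _ , inj₂ z∈u | x~z , _   = proper x z x~z (trans x∈u (sym z∈u))
    ... | x~y , inj₂ y∈u | _ | _ , inj₁ x∈u         = proper x y x~y (trans x∈u (sym y∈u))
    ... | _   , inj₂ y∈u | y~z , _ | _ , inj₂ z∈u   = proper y z y~z (trans y∈u (sym z∈u))

    size-avoiding-2F : size (avoiding 2F) ≤ ∣ 0F ∣ * ∣ 1F ∣
    size-avoiding-2F = *-cancelˡ-≤ 2 (begin
      2 * size F                                          ≡⟨ countPairs-double (inF F) (symF F) (λ x → cong (_∧ _) (irrefl G x)) ⟩
      ∑[ x < n ] ∑[ y < n ] f x y                         ≡⟨ ∑∑-cross-blocks f (λ x y → cong 𝟙 (symF F x y)) same-colour ⟩
      2 * (block 0F 1F f + block 0F 2F f + block 1F 2F f) ≡⟨ cong₂ (λ a b → 2 * (block 0F 1F f + a + b)) (into-2F 0F) (into-2F 1F) ⟩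
      2 * (block 0F 1F f + 0 + 0)                         ≡⟨ cong (2 *_) (trans (+-identityʳ (block 0F 1F f + 0)) (+-identityʳ (block 0F 1F f))) ⟩
      2 * block 0F 1F f                                   ≤⟨ *-monoʳ-≤ 2 (block-≤ 0F 1F f λ x y → 𝟙≤1 (inF F x y)) ⟩
      2 * (∣ 0F ∣ * ∣ 1F ∣)                               ∎)
      where
      open ≤-Reasoning
      F = avoiding 2F
      f : Fin n → Fin n → ℕ
      f x y = 𝟙 (inF F x y)
      same-colour : ∀ x y → c x ≡ c y → f x y ≡ 0
      same-colour x y cx≡cy = cong (λ a → 𝟙 (a ∧ not (meets 2F x y))) (adj-same-colour cx≡cy)
      into-2F : ∀ s → block s 2F f ≡ 0
      into-2F s = block-zero s 2F f λ x y _ cy≡2 →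
        cong 𝟙 (∧-not-T (adj G x y) (Equivalence.from T-∨ (inj₂ (fromWitness {a? = c y ≟ 2F} cy≡2))))

    τ≤∣0∣*∣1∣ : ∀ {t} → IsTau G t → t ≤ ∣ 0F ∣ * ∣ 1F ∣
    τ≤∣0∣*∣1∣ (_ , minimal) = ≤-trans (minimal (avoiding 2F) (avoiding-isCover 2F)) size-avoiding-2F

    module LatinPacking (0≤2 : ∣ 0F ∣ ≤ ∣ 2F ∣) (1≤2 : ∣ 1F ∣ ≤ ∣ 2F ∣) where

      Pair : Set
      Pair = Fin ∣ 0F ∣ × Fin ∣ 1F ∣

      σ : Fin ∣ 0F ∣ → Fin ∣ 1F ∣ → Fin ∣ 2F ∣
      σ = proj₁ (latinRectangle 0≤2 1≤2)

      σ-injʳ : ∀ i → Injective _≡_ _≡_ (σ i)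
      σ-injʳ = proj₁ (proj₂ (latinRectangle 0≤2 1≤2))

      σ-injˡ : ∀ j → Injective _≡_ _≡_ (λ i → σ i j)
      σ-injˡ = proj₂ (proj₂ (latinRectangle 0≤2 1≤2))

      vertex : Fin 3 → Pair → Fin n
      vertex 0F (i , j) = member 0F i
      vertex 1F (i , j) = member 1F j
      vertex 2F (i , j) = member 2F (σ i j)

      colour-vertex : ∀ s p → c (vertex s p) ≡ s
      colour-vertex 0F (i , j) = colour-member 0F i
      colour-vertex 1F (i , j) = colour-member 1F j
      colour-vertex 2F (i , j) = colour-member 2F (σ i j)

      -- σ is a Latin rectangle, so any two of i, j and σ i j determine (i , j).
      vertices-determine : ∀ {s t p q} → s ≢ t → vertex s p ≡ vertex s q → vertex t p ≡ vertex t q → p ≡ q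
      vertices-determine {0F} {0F} s≢t _ _ = ⊥-elim (s≢t refl)
      vertices-determine {1F} {1F} s≢t _ _ = ⊥-elim (s≢t refl)
      vertices-determine {2F} {2F} s≢t _ _ = ⊥-elim (s≢t refl)
      vertices-determine {0F} {1F} {i , j} {i′ , j′} _ e₀ e₁ =
        cong₂ _,_ (member-injective 0F e₀) (member-injective 1F e₁)
      vertices-determine {0F} {2F} {i , j} {i′ , j′} _ e₀ e₂ with refl ← member-injective 0F e₀ =
        cong (i ,_) (σ-injʳ i (member-injective 2F e₂))
      vertices-determine {1F} {2F} {i , j} {i′ , j′} _ e₁ e₂ with refl ← member-injective 1F e₁ =
        cong (_, j) (σ-injˡ j (member-injective 2F e₂))
      vertices-determine {1F} {0F} s≢t e₁ e₀ = vertices-determine (s≢t ∘ sym) e₀ e₁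
      vertices-determine {2F} {0F} s≢t e₂ e₀ = vertices-determine (s≢t ∘ sym) e₀ e₂
      vertices-determine {2F} {1F} s≢t e₂ e₁ = vertices-determine (s≢t ∘ sym) e₁ e₂

      good : Pair → Bool
      good p = adj G (vertex 0F p) (vertex 1F p) ∧ adj G (vertex 1F p) (vertex 2F p) ∧ adj G (vertex 0F p) (vertex 2F p)

      triangle : ∀ p → T (good p) → Triangle G
      triangle p g = record
        { v₁ = vertex 0F p ; v₂ = vertex 1F p ; v₃ = vertex 2F p
        ; e₁₂ = proj₁ g₁ ; e₂₃ = proj₁ g₂ ; e₁₃ = proj₂ g₂ }
        where
        g₁ = Equivalence.to T-∧ g
        g₂ = Equivalence.to T-∧ (proj₂ g₁)

      ∈▵⇒vertex : ∀ {p g u} → u ∈▵ triangle p g → u ≡ vertex (c u) p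
      ∈▵⇒vertex {p} (inj₁ refl)        = cong (λ s → vertex s p) (sym (colour-vertex 0F p))
      ∈▵⇒vertex {p} (inj₂ (inj₁ refl)) = cong (λ s → vertex s p) (sym (colour-vertex 1F p))
      ∈▵⇒vertex {p} (inj₂ (inj₂ refl)) = cong (λ s → vertex s p) (sym (colour-vertex 2F p))

      triangles-edge-disjoint : ∀ {p q g h} → p ≢ q → ¬ ShareEdge (triangle p g) (triangle q h)
      triangles-edge-disjoint {p} {q} {g} {h} p≢q (u , v , u≢v , u∈p , v∈p , u∈q , v∈q) =
        p≢q (vertices-determine colours-differ (agree u∈p u∈q) (agree v∈p v∈q))
        where
        agree : ∀ {w} → w ∈▵ triangle p g → w ∈▵ triangle q h → vertex (c w) p ≡ vertex (c w) q
        agree w∈p w∈q = trans (sym (∈▵⇒vertex {g = g} w∈p)) (∈▵⇒vertex {g = h} w∈q)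
        colours-differ : c u ≢ c v
        colours-differ cu≡cv = u≢v (trans (∈▵⇒vertex {g = g} u∈p) (trans (cong (λ s → vertex s p) cu≡cv) (sym (∈▵⇒vertex {g = g} v∈p))))

      allPairs goodPairs : List Pair
      allPairs  = cartesianProduct (allFin ∣ 0F ∣) (allFin ∣ 1F ∣)
      goodPairs = filter (T? ∘ good) allPairs

      latinPacking : Packing G (length goodPairs)
      latinPacking = (λ k → triangle (lookup goodPairs k) (isGood k)) ,
                     (λ k l k≢l → triangles-edge-disjoint {g = isGood k} {h = isGood l} (k≢l ∘ lookup-injective unique))
        where
        isGood : ∀ k → T (good (lookup goodPairs k))
        isGood k = All.lookup (all-filter (T? ∘ good) allPairs) (∈-lookup k)
        unique : Unique goodPairs
        unique = Uniqueₚ.filter⁺ (T? ∘ good) (Uniqueₚ.cartesianProduct⁺ (Uniqueₚ.allFin⁺ _) (Uniqueₚ.allFin⁺ _))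

      non-edge : Fin n → Fin n → ℕ
      non-edge x y = 𝟙 (not (adj G x y))

      missing : Pair → ℕ
      missing p = non-edge (vertex 0F p) (vertex 1F p) + non-edge (vertex 0F p) (vertex 2F p) + non-edge (vertex 1F p) (vertex 2F p)

      1≤good+missing : ∀ p → 1 ≤ 𝟙 (good p) + missing p
      1≤good+missing p = 1≤𝟙∧+𝟙-not (adj G (vertex 0F p) (vertex 1F p)) (adj G (vertex 1F p) (vertex 2F p)) (adj G (vertex 0F p) (vertex 2F p))

      length-goodPairs : length goodPairs ≡ ∑[ i < ∣ 0F ∣ ] ∑[ j < ∣ 1F ∣ ] 𝟙 (good (i , j))
      length-goodPairs = begin
        length goodPairs
          ≡⟨ length-filter≡sum (T? ∘ good) allPairs ⟩
        sum (map (𝟙 ∘ good) allPairs)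
          ≡⟨ sum-map-cartesianProduct (𝟙 ∘ good) (allFin ∣ 0F ∣) (allFin ∣ 1F ∣) ⟩
        sum (map (λ i → sum (map (λ j → 𝟙 (good (i , j))) (allFin ∣ 1F ∣))) (allFin ∣ 0F ∣))
          ≡⟨ sum-map-allFin (λ i → sum (map (λ j → 𝟙 (good (i , j))) (allFin ∣ 1F ∣))) ⟩
        ∑[ i < ∣ 0F ∣ ] sum (map (λ j → 𝟙 (good (i , j))) (allFin ∣ 1F ∣))
          ≡⟨ sum-cong-≗ (λ i → sum-map-allFin (λ j → 𝟙 (good (i , j)))) ⟩
        ∑[ i < ∣ 0F ∣ ] ∑[ j < ∣ 1F ∣ ] 𝟙 (good (i , j)) ∎
        where open ≡-Reasoning

      ∑missing≤ : ∑[ i < ∣ 0F ∣ ] ∑[ j < ∣ 1F ∣ ] missing (i , j) ≤ M 0F 1F + M 0F 2F + M 1F 2F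
      ∑missing≤ = begin
        ∑[ i < ∣ 0F ∣ ] ∑[ j < ∣ 1F ∣ ] (AB i j + AC i j + BC i j)
          ≡⟨ ∑∑-distrib-+ (λ i j → AB i j + AC i j) BC ⟩
        ∑[ i < ∣ 0F ∣ ] ∑[ j < ∣ 1F ∣ ] (AB i j + AC i j) + ∑[ i < ∣ 0F ∣ ] ∑[ j < ∣ 1F ∣ ] BC i j
          ≡⟨ cong (_+ ∑[ i < ∣ 0F ∣ ] ∑[ j < ∣ 1F ∣ ] BC i j) (∑∑-distrib-+ AB AC) ⟩
        M 0F 1F + ∑[ i < ∣ 0F ∣ ] ∑[ j < ∣ 1F ∣ ] AC i j + ∑[ i < ∣ 0F ∣ ] ∑[ j < ∣ 1F ∣ ] BC i j
          ≤⟨ +-mono-≤ (+-monoʳ-≤ (M 0F 1F) AC≤) BC≤ ⟩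
        M 0F 1F + M 0F 2F + M 1F 2F ∎
        where
        open ≤-Reasoning
        AB AC BC : Fin ∣ 0F ∣ → Fin ∣ 1F ∣ → ℕ
        AB i j = non-edge (member 0F i) (member 1F j)
        AC i j = non-edge (member 0F i) (member 2F (σ i j))
        BC i j = non-edge (member 1F j) (member 2F (σ i j))
        AC≤ : ∑[ i < ∣ 0F ∣ ] ∑[ j < ∣ 1F ∣ ] AC i j ≤ M 0F 2F
        AC≤ = ∑-mono-≤ λ i → ∑-injective-≤ (non-edge (member 0F i) ∘ member 2F) (σ-injʳ i)
        BC≤ : ∑[ i < ∣ 0F ∣ ] ∑[ j < ∣ 1F ∣ ] BC i j ≤ M 1F 2F
        BC≤ = begin
          ∑[ i < ∣ 0F ∣ ] ∑[ j < ∣ 1F ∣ ] BC i j ≡⟨ ∑-comm BC ⟩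
          ∑[ j < ∣ 1F ∣ ] ∑[ i < ∣ 0F ∣ ] BC i j ≤⟨ ∑-mono-≤ (λ j → ∑-injective-≤ (non-edge (member 1F j) ∘ member 2F) (σ-injˡ j)) ⟩
          M 1F 2F                                 ∎

      ∣0∣*∣1∣≤good+missing : ∣ 0F ∣ * ∣ 1F ∣ ≤ length goodPairs + (M 0F 1F + M 0F 2F + M 1F 2F)
      ∣0∣*∣1∣≤good+missing = begin
        ∣ 0F ∣ * ∣ 1F ∣
          ≡⟨ block-ones 0F 1F ⟨
        ∑[ i < ∣ 0F ∣ ] ∑[ j < ∣ 1F ∣ ] 1
          ≤⟨ ∑-mono-≤ (λ i → ∑-mono-≤ λ j → 1≤good+missing (i , j)) ⟩
        ∑[ i < ∣ 0F ∣ ] ∑[ j < ∣ 1F ∣ ] (𝟙 (good (i , j)) + missing (i , j))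
          ≡⟨ ∑∑-distrib-+ (λ i j → 𝟙 (good (i , j))) (λ i j → missing (i , j)) ⟩
        ∑[ i < ∣ 0F ∣ ] ∑[ j < ∣ 1F ∣ ] 𝟙 (good (i , j)) + ∑[ i < ∣ 0F ∣ ] ∑[ j < ∣ 1F ∣ ] missing (i , j)
          ≤⟨ +-mono-≤ (≤-reflexive (sym length-goodPairs)) ∑missing≤ ⟩
        length goodPairs + (M 0F 1F + M 0F 2F + M 1F 2F) ∎
        where open ≤-Reasoning

      ∣0∣*∣1∣≤ν+M : ∀ {k} → IsNu G k → ∣ 0F ∣ * ∣ 1F ∣ ≤ k + (M 0F 1F + M 0F 2F + M 1F 2F)
      ∣0∣*∣1∣≤ν+M (_ , maximal) = ≤-trans ∣0∣*∣1∣≤good+missing (+-monoˡ-≤ _ (maximal _ latinPacking))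

  -- The counting inequality

  2xy≤x²+y² : ∀ x y → 2 * (x * y) ≤ x * x + y * y
  2xy≤x²+y² x y with ≤-total x y
  ... | inj₁ x≤y with d , refl ← m≤n⇒∃[o]m+o≡n x≤y = subst (2 * (x * (x + d)) ≤_) (sym (square-gap x d)) (m≤m+n _ _)
    where
    square-gap : ∀ x d → x * x + (x + d) * (x + d) ≡ 2 * (x * (x + d)) + d * d
    square-gap = solve-∀
  ... | inj₂ y≤x with d , refl ← m≤n⇒∃[o]m+o≡n y≤x = subst (2 * ((y + d) * y) ≤_) (sym (square-gap y d)) (m≤m+n _ _)
    where
    square-gap : ∀ y d → (y + d) * (y + d) + y * y ≡ 2 * ((y + d) * y) + d * d
    square-gap = solve-∀

  3[ab+ac+bc]≤[a+b+c]² : ∀ a b c → 3 * (a * b + a * c + b * c) ≤ (a + b + c) * (a + b + c)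
  3[ab+ac+bc]≤[a+b+c]² a b c = *-cancelˡ-≤ 2 (begin
    2 * (3 * (a * b + a * c + b * c))                                         ≡⟨ split a b c ⟩
    4 * (a * b + a * c + b * c) + (2 * (a * b) + 2 * (a * c) + 2 * (b * c))   ≤⟨ +-monoʳ-≤ (4 * (a * b + a * c + b * c)) (+-mono-≤ (+-mono-≤ (2xy≤x²+y² a b) (2xy≤x²+y² a c)) (2xy≤x²+y² b c)) ⟩
    4 * (a * b + a * c + b * c) + ((a * a + b * b) + (a * a + c * c) + (b * b + c * c)) ≡⟨ join a b c ⟩
    2 * ((a + b + c) * (a + b + c))                                           ∎)
    where
    open ≤-Reasoning
    split : ∀ a b c → 2 * (3 * (a * b + a * c + b * c)) ≡ 4 * (a * b + a * c + b * c) + (2 * (a * b) + 2 * (a * c) + 2 * (b * c))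
    split = solve-∀
    join : ∀ a b c → 4 * (a * b + a * c + b * c) + ((a * a + b * b) + (a * a + c * c) + (b * b + c * c)) ≡ 2 * ((a + b + c) * (a + b + c))
    join = solve-∀

  4[ac+bc]≤[a+b+c]² : ∀ a b c → 4 * (a * c + b * c) ≤ (a + b + c) * (a + b + c)
  4[ac+bc]≤[a+b+c]² a b c = begin
    4 * (a * c + b * c)                                  ≡⟨ split a b c ⟩
    2 * ((a + b) * c) + 2 * ((a + b) * c)                ≤⟨ +-monoʳ-≤ (2 * ((a + b) * c)) (2xy≤x²+y² (a + b) c) ⟩
    2 * ((a + b) * c) + ((a + b) * (a + b) + c * c)      ≡⟨ join a b c ⟩
    (a + b + c) * (a + b + c)                            ∎
    where
    open ≤-Reasoning
    split : ∀ a b c → 4 * (a * c + b * c) ≡ 2 * ((a + b) * c) + 2 * ((a + b) * c)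
    split = solve-∀
    join : ∀ a b c → 2 * ((a + b) * c) + ((a + b) * (a + b) + c * c) ≡ (a + b + c) * (a + b + c)
    join = solve-∀

  -- With A, B, C the colour classes 0F, 1F, 2F: x = |A||B|, y = |A||C| + |B||C|, N = n², e = e(G),
  -- and m counts the non-adjacent pairs of vertices in different classes.
  module _ {x y N e m : ℕ} (e+m≡x+y : e + m ≡ x + y) (3[x+y]≤N : 3 * (x + y) ≤ N) where

    density⇒q<p : ∀ {p q} → (q + 3 * p) * N < 12 * p * e → q < p
    density⇒q<p {p} {q} dense = +-cancelʳ-< (3 * p) q p (*-cancelʳ-< N (q + 3 * p) (p + 3 * p) (begin-strict
      (q + 3 * p) * N      <⟨ dense ⟩
      12 * p * e           ≤⟨ *-monoʳ-≤ (12 * p) (subst (e ≤_) e+m≡x+y (m≤m+n e m)) ⟩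
      12 * p * (x + y)     ≡⟨ regroup p (x + y) ⟩
      4 * p * (3 * (x + y)) ≤⟨ *-monoʳ-≤ (4 * p) 3[x+y]≤N ⟩
      4 * p * N            ≡⟨ cong (_* N) (four p) ⟩
      (p + 3 * p) * N      ∎))
      where
      open ≤-Reasoning
      regroup : ∀ p s → 12 * p * s ≡ 4 * p * (3 * s)
      regroup = solve-∀
      four : ∀ p → 4 * p ≡ p + 3 * p
      four = solve-∀

    density⇒few-missing : ∀ {q r} → 4 * y ≤ N → (q + 3 * (q + r)) * N < 12 * (q + r) * e → (q + r) * m < r * x
    density⇒few-missing {q} {r} 4y≤N dense = *-cancelˡ-< 12 _ _ (+-cancelˡ-< ((q + 3 * (q + r)) * N) _ _ (begin-strict
      (q + 3 * (q + r)) * N + 12 * ((q + r) * m)              <⟨ +-monoˡ-< _ dense ⟩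
      12 * (q + r) * e + 12 * ((q + r) * m)                   ≡⟨ factor q r e m ⟩
      12 * (q + r) * (e + m)                                  ≡⟨ cong (12 * (q + r) *_) e+m≡x+y ⟩
      12 * (q + r) * (x + y)                                  ≡⟨ expand q r x y ⟩
      4 * q * (3 * (x + y)) + 3 * r * (4 * y) + 12 * (r * x)  ≤⟨ +-monoˡ-≤ _ (+-mono-≤ (*-monoʳ-≤ (4 * q) 3[x+y]≤N) (*-monoʳ-≤ (3 * r) 4y≤N)) ⟩
      4 * q * N + 3 * r * N + 12 * (r * x)                    ≡⟨ cong (_+ 12 * (r * x)) (collect q r N) ⟩
      (q + 3 * (q + r)) * N + 12 * (r * x)                    ∎))
      where
      open ≤-Reasoning
      factor : ∀ q r e m → 12 * (q + r) * e + 12 * ((q + r) * m) ≡ 12 * (q + r) * (e + m)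
      factor = solve-∀
      expand : ∀ q r x y → 12 * (q + r) * (x + y) ≡ 4 * q * (3 * (x + y)) + 3 * r * (4 * y) + 12 * (r * x)
      expand = solve-∀
      collect : ∀ q r N → 4 * q * N + 3 * r * N ≡ (q + 3 * (q + r)) * N
      collect = solve-∀

    density⇒qτ<pν : ∀ {t k p q} → 4 * y ≤ N → t ≤ x → x ≤ k + m → (q + 3 * p) * N < 12 * p * e → q * t < p * k
    density⇒qτ<pν {t} {k} {p} {q} 4y≤N t≤x x≤k+m dense = +-cancelʳ-< (r * x) (q * t) (p * k) (begin-strict
      q * t + r * x           ≤⟨ +-monoˡ-≤ (r * x) (*-monoʳ-≤ q t≤x) ⟩
      q * x + r * x           ≡⟨ *-distribʳ-+ x q r ⟨
      (q + r) * x             ≡⟨ cong (_* x) q+r≡p ⟩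
      p * x                   ≤⟨ *-monoʳ-≤ p x≤k+m ⟩
      p * (k + m)             ≡⟨ *-distribˡ-+ p k m ⟩
      p * k + p * m           <⟨ +-monoʳ-< (p * k) few-missing ⟩
      p * k + r * x           ∎)
      where
      open ≤-Reasoning
      r = p ∸ q
      q+r≡p : q + r ≡ p
      q+r≡p = m+[n∸m]≡n (<⇒≤ (density⇒q<p {p} {q} dense))
      few-missing : p * m < r * x
      few-missing = subst (λ p′ → p′ * m < r * x) q+r≡p
        (density⇒few-missing {q} {r} 4y≤N (subst (λ p′ → (q + 3 * p′) * N < 12 * p′ * e) (sym q+r≡p) dense))

  qτ<pν-largest-last : ∀ {n} (G : Graph n) (c : Fin n → Fin 3) → Proper G c →
    classSize c 0F ≤ classSize c 2F → classSize c 1F ≤ classSize c 2F →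
    ∀ {t k p q} → (q + 3 * p) * (n * n) < 12 * p * edges G → IsTau G t → IsNu G k → q * t < p * k
  qτ<pν-largest-last {n} G c proper 0≤2 1≤2 {t} {k} {p} {q} dense τ ν =
    density⇒qτ<pν {N = N} {e = edges G} edges+missing
      (subst (_≤ N) (cong (3 *_) (+-assoc (a * b) (a * d) (b * d))) (3[ab+ac+bc]≤[a+b+c]² a b d))
      {t} {k} {p} {q} (4[ac+bc]≤[a+b+c]² a b d) (τ≤∣0∣*∣1∣ τ) (∣0∣*∣1∣≤ν+M ν)
      (subst (λ v → (q + 3 * p) * (v * v) < 12 * p * edges G) n≡a+b+d dense)
    where
    open ColourClasses c
    open Tripartition G c proper
    open LatinPacking 0≤2 1≤2
    a = ∣ 0F ∣
    b = ∣ 1F ∣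
    d = ∣ 2F ∣
    N = (a + b + d) * (a + b + d)
    n≡a+b+d : n ≡ a + b + d
    n≡a+b+d = trans n≡∑∣class∣ (trans (cong (a +_) (cong (b +_) (+-identityʳ d))) (sym (+-assoc a b d)))

  recolour-proper : ∀ {n k} {G : Graph n} {c : Fin n → Fin k} (π : Permutation k k) → Proper G c → Proper G ((π ⟨$⟩ʳ_) ∘ c)
  recolour-proper π proper i j i~j πci≡πcj =
    proper i j i~j (trans (sym (inverseˡ π)) (trans (cong (π ⟨$⟩ˡ_) πci≡πcj) (inverseˡ π)))

  classSize-recolour : ∀ {n k} (c : Fin n → Fin k) (π : Permutation k k) s →
                       classSize ((π ⟨$⟩ʳ_) ∘ c) s ≡ classSize c (π ⟨$⟩ˡ s)
  classSize-recolour {n} c π s = cong length (filter-≐ (λ x → π ⟨$⟩ʳ c x ≟ s) (λ x → c x ≟ π ⟨$⟩ˡ s)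
    ((λ πcx≡s → trans (sym (inverseˡ π)) (cong (π ⟨$⟩ˡ_) πcx≡s)) , (λ cx≡π⁻¹s → trans (cong (π ⟨$⟩ʳ_) cx≡π⁻¹s) (inverseʳ π)))
    (allFin n))

  LargestClassLast : ∀ {n} → Graph n → Set
  LargestClassLast {n} G =
    Σ[ c ∈ (Fin n → Fin 3) ] Proper G c × classSize c 0F ≤ classSize c 2F × classSize c 1F ≤ classSize c 2F

  recoloured : ∀ {n} {G : Graph n} {c : Fin n → Fin 3} → Proper G c → (π : Permutation 3 3) →
               classSize c (π ⟨$⟩ˡ 0F) ≤ classSize c (π ⟨$⟩ˡ 2F) → classSize c (π ⟨$⟩ˡ 1F) ≤ classSize c (π ⟨$⟩ˡ 2F) →
               LargestClassLast G
  recoloured {G = G} {c} proper π 0≤2 1≤2 =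
    (π ⟨$⟩ʳ_) ∘ c , recolour-proper {G = G} {c} π proper ,
    subst₂ _≤_ (sym (classSize-recolour c π 0F)) (sym (classSize-recolour c π 2F)) 0≤2 ,
    subst₂ _≤_ (sym (classSize-recolour c π 1F)) (sym (classSize-recolour c π 2F)) 1≤2

  largest-class-last : ∀ {n} {G : Graph n} → Tripartite G → LargestClassLast G
  largest-class-last {G = G} (c , proper) with ≤-total (classSize c 0F) (classSize c 1F)
  ... | inj₁ 0≤1 with ≤-total (classSize c 1F) (classSize c 2F)
  ...   | inj₁ 1≤2 = c , proper , ≤-trans 0≤1 1≤2 , 1≤2
  ...   | inj₂ 2≤1 = recoloured {G = G} {c} proper (transpose 1F 2F) 0≤1 2≤1
  largest-class-last {G = G} (c , proper) | inj₂ 1≤0 with ≤-total (classSize c 0F) (classSize c 2F)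
  ...   | inj₁ 0≤2 = c , proper , 0≤2 , ≤-trans 1≤0 0≤2
  ...   | inj₂ 2≤0 = recoloured {G = G} {c} proper (transpose 0F 2F) 2≤0 1≤0

  qτ<pν : ∀ {n} (G : Graph n) → Tripartite G →
          ∀ {t k p q} → (q + 3 * p) * (n * n) < 12 * p * edges G → IsTau G t → IsNu G k → q * t < p * k
  qτ<pν G tripartite {t} {k} {p} {q} with c , proper , 0≤2 , 1≤2 ← largest-class-last {G = G} tripartite =
    qτ<pν-largest-last G c proper 0≤2 1≤2 {t} {k} {p} {q}

-- The rational form

open import Data.Nat using (ℕ; _*_; _<_)
import Data.Nat as ℕ
import Data.Nat.Properties as ℕₚ
open import Data.Nat.Coprimality using (Coprime; 1-coprimeTo) renaming (sym to coprime-sym)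
open import Data.Nat.Tactic.RingSolver using (solve-∀)
open import Data.Integer using (+_; -[1+_])
import Data.Integer as ℤ
import Data.Integer.Properties as ℤₚ
open import Data.Rational using (ℚ; mkℚ; 0ℚ; 1ℚ; _+_; _/_; toℚᵘ)
import Data.Rational as ℚ
import Data.Rational.Properties as ℚₚ
open import Data.Rational.Solver using (module +-*-Solver)
open import Data.Rational.Unnormalised using (mkℚᵘ)
import Data.Rational.Unnormalised as ℚᵘ
import Data.Rational.Unnormalised.Properties as ℚᵘₚ
open import Data.Product using (_×_; _,_)
open import Relation.Binary.PropositionalEquality
open Counting using (qτ<pν)

ι : ℕ → ℚ
ι m = + m / 1

toℚᵘ-ι : ∀ m → toℚᵘ (ι m) ≡ mkℚᵘ (+ m) 0
toℚᵘ-ι m = cong toℚᵘ (ℚₚ.normalize-coprime (coprime-sym (1-coprimeTo m)))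

ι-+ : ∀ m k → ι (m ℕ.+ k) ≡ ι m + ι k
ι-+ m k = ℚₚ.toℚᵘ-injective (begin
  toℚᵘ (ι (m ℕ.+ k))                    ≡⟨ toℚᵘ-ι (m ℕ.+ k) ⟩
  mkℚᵘ (+ (m ℕ.+ k)) 0                  ≈⟨ ℚᵘ.*≡* (cong (ℤ._* + 1) (trans (ℤₚ.pos-+ m k) (sym (cong₂ ℤ._+_ (ℤₚ.*-identityʳ (+ m)) (ℤₚ.*-identityʳ (+ k)))))) ⟩
  mkℚᵘ (+ m) 0 ℚᵘ.+ mkℚᵘ (+ k) 0      ≡⟨ cong₂ ℚᵘ._+_ (toℚᵘ-ι m) (toℚᵘ-ι k) ⟨
  toℚᵘ (ι m) ℚᵘ.+ toℚᵘ (ι k)          ≈⟨ ℚₚ.toℚᵘ-homo-+ (ι m) (ι k) ⟨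
  toℚᵘ (ι m + ι k)                  ∎)
  where open ℚᵘₚ.≃-Reasoning

ι-* : ∀ m k → ι (m * k) ≡ ι m ℚ.* ι k
ι-* m k = ℚₚ.toℚᵘ-injective (begin
  toℚᵘ (ι (m * k))                    ≡⟨ toℚᵘ-ι (m * k) ⟩
  mkℚᵘ (+ (m * k)) 0                  ≈⟨ ℚᵘ.*≡* (cong (ℤ._* + 1) (ℤₚ.pos-* m k)) ⟩
  mkℚᵘ (+ m) 0 ℚᵘ.* mkℚᵘ (+ k) 0      ≡⟨ cong₂ ℚᵘ._*_ (toℚᵘ-ι m) (toℚᵘ-ι k) ⟨
  toℚᵘ (ι m) ℚᵘ.* toℚᵘ (ι k)          ≈⟨ ℚₚ.toℚᵘ-homo-* (ι m) (ι k) ⟨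
  toℚᵘ (ι m ℚ.* ι k)                  ∎)
  where open ℚᵘₚ.≃-Reasoning

ι-mono-< : ∀ {m k} → m ℕ.< k → ι m ℚ.< ι k
ι-mono-< {m} {k} m<k = ℚₚ.toℚᵘ-cancel-< (subst₂ ℚᵘ._<_ (sym (toℚᵘ-ι m)) (sym (toℚᵘ-ι k))
  (ℚᵘ.*<* (subst₂ ℤ._<_ (sym (ℤₚ.*-identityʳ (+ m))) (sym (ℤₚ.*-identityʳ (+ k))) (ℤ.+<+ m<k))))

ι-cancel-< : ∀ {m k} → ι m ℚ.< ι k → m ℕ.< k
ι-cancel-< {m} {k} ιm<ιk with subst₂ ℚᵘ._<_ (toℚᵘ-ι m) (toℚᵘ-ι k) (ℚₚ.toℚᵘ-mono-< ιm<ιk)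
... | ℚᵘ.*<* m*1<k*1 = ℤₚ.drop‿+<+ (subst₂ ℤ._<_ (ℤₚ.*-identityʳ (+ m)) (ℤₚ.*-identityʳ (+ k)) m*1<k*1)

α*denominator≡numerator : ∀ P d .(c : Coprime P (ℕ.suc d)) → mkℚ (+ P) d c ℚ.* ι (ℕ.suc d) ≡ ι P
α*denominator≡numerator P d c = ℚₚ.toℚᵘ-injective (begin
  toℚᵘ (mkℚ (+ P) d c ℚ.* ι (ℕ.suc d))          ≈⟨ ℚₚ.toℚᵘ-homo-* (mkℚ (+ P) d c) (ι (ℕ.suc d)) ⟩
  mkℚᵘ (+ P) d ℚᵘ.* toℚᵘ (ι (ℕ.suc d))          ≡⟨ cong (mkℚᵘ (+ P) d ℚᵘ.*_) (toℚᵘ-ι (ℕ.suc d)) ⟩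
  mkℚᵘ (+ P) d ℚᵘ.* mkℚᵘ (+ ℕ.suc d) 0          ≈⟨ ℚᵘ.*≡* (trans (ℤₚ.*-identityʳ _) (cong (+ P ℤ.*_) (cong +_ (sym (ℕₚ.*-identityʳ (ℕ.suc d)))))) ⟩
  mkℚᵘ (+ P) 0                                   ≡⟨ toℚᵘ-ι P ⟨
  toℚᵘ (ι P)                                     ∎)
  where open ℚᵘₚ.≃-Reasoning

τ<αν : (α : ℚ) → 0ℚ ℚ.< α → ∀ n (G : Graph n) → Tripartite G →
       (1ℚ + ι 3 ℚ.* α) ℚ.* ι (n * n) ℚ.< ι 12 ℚ.* α ℚ.* ι (edges G) →
       ∀ t k → IsTau G t → IsNu G k → ι t ℚ.< α ℚ.* ι k
τ<αν (mkℚ -[1+ _ ] _ _) 0<α with () ← ℚ.positive 0<α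
τ<αν α@(mkℚ (+ P) d c) _ n G tripartite dense t k τ ν =
  ℚₚ.*-cancelʳ-<-nonNeg (ι D) {{ℚₚ.pos⇒nonNeg (ι D)}}
    (subst₂ ℚ._<_ (unscale-τ) (unscale-ν) (ι-mono-< (qτ<pν G tripartite {p = P} {q = D} dense-ℕ τ ν)))
  where
  open ≡-Reasoning
  open +-*-Solver using (solve; _:+_; _:*_; _:=_)
  D = ℕ.suc d
  αD≡P : α ℚ.* ι D ≡ ι P
  αD≡P = α*denominator≡numerator P d c
  instance
    ιD-positive : ℚ.Positive (ι D)
    ιD-positive = ℚ.positive (ι-mono-< {0} {D} (ℕ.s≤s ℕ.z≤n))
  scale-density : (1ℚ + ι 3 ℚ.* α) ℚ.* ι (n * n) ℚ.* ι D ≡ ι ((D ℕ.+ 3 * P) * (n * n))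
  scale-density = begin
    (1ℚ + ι 3 ℚ.* α) ℚ.* ι (n * n) ℚ.* ι D
      ≡⟨ solve 5 (λ x y a z w → (x :+ y :* a) :* z :* w := (x :* w :+ y :* (a :* w)) :* z) refl 1ℚ (ι 3) α (ι (n * n)) (ι D) ⟩
    (1ℚ ℚ.* ι D + ι 3 ℚ.* (α ℚ.* ι D)) ℚ.* ι (n * n)
      ≡⟨ cong₂ (λ u v → (u + ι 3 ℚ.* v) ℚ.* ι (n * n)) (ℚₚ.*-identityˡ (ι D)) αD≡P ⟩
    (ι D + ι 3 ℚ.* ι P) ℚ.* ι (n * n)
      ≡⟨ cong (ℚ._* ι (n * n)) (trans (ι-+ D (3 * P)) (cong (λ v → ι D + v) (ι-* 3 P))) ⟨
    ι (D ℕ.+ 3 * P) ℚ.* ι (n * n)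
      ≡⟨ ι-* (D ℕ.+ 3 * P) (n * n) ⟨
    ι ((D ℕ.+ 3 * P) * (n * n)) ∎
  scale-edges : ι 12 ℚ.* α ℚ.* ι (edges G) ℚ.* ι D ≡ ι (12 * P * edges G)
  scale-edges = begin
    ι 12 ℚ.* α ℚ.* ι (edges G) ℚ.* ι D
      ≡⟨ solve 4 (λ x a e w → x :* a :* e :* w := x :* (a :* w) :* e) refl (ι 12) α (ι (edges G)) (ι D) ⟩
    ι 12 ℚ.* (α ℚ.* ι D) ℚ.* ι (edges G)
      ≡⟨ cong (λ v → ι 12 ℚ.* v ℚ.* ι (edges G)) αD≡P ⟩
    ι 12 ℚ.* ι P ℚ.* ι (edges G)
      ≡⟨ trans (ι-* (12 * P) (edges G)) (cong (ℚ._* ι (edges G)) (ι-* 12 P)) ⟨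
    ι (12 * P * edges G) ∎
  dense-ℕ : (D ℕ.+ 3 * P) * (n * n) < 12 * P * edges G
  dense-ℕ = ι-cancel-< (subst₂ ℚ._<_ scale-density scale-edges (ℚₚ.*-monoˡ-<-pos (ι D) dense))
  unscale-τ : ι (D * t) ≡ ι t ℚ.* ι D
  unscale-τ = trans (ι-* D t) (ℚₚ.*-comm (ι D) (ι t))
  unscale-ν : ι (P * k) ≡ α ℚ.* ι k ℚ.* ι D
  unscale-ν = begin
    ι (P * k)              ≡⟨ ι-* P k ⟩
    ι P ℚ.* ι k            ≡⟨ cong (ℚ._* ι k) αD≡P ⟨
    α ℚ.* ι D ℚ.* ι k      ≡⟨ solve 3 (λ a w x → a :* w :* x := a :* x :* w) refl α (ι D) (ι k) ⟩
    α ℚ.* ι k ℚ.* ι D      ∎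

33N<112e⇒[15+3·28]N<12·28e : ∀ {N e} → 33 * N < 112 * e → (15 ℕ.+ 3 * 28) * N < 12 * 28 * e
33N<112e⇒[15+3·28]N<12·28e {N} {e} dense = subst₂ _<_ (times-3 N) (times-3′ e) (ℕₚ.*-monoʳ-< 3 dense)
  where
  times-3 : ∀ N → 3 * (33 * N) ≡ (15 ℕ.+ 3 * 28) * N
  times-3 = solve-∀
  times-3′ : ∀ e → 3 * (112 * e) ≡ 12 * 28 * e
  times-3′ = solve-∀

corollary3 :
    ((α : ℚ) → 0ℚ ℚ.< α → ∀ (n : ℕ) (G : Graph n) → Tripartite G →
       -- e(G) > (1+3α)/(12α) n², written as (1+3α)·n² < 12α·e(G) (α > 0)
       (1ℚ + ((+ 3) / 1) ℚ.* α) ℚ.* ((+ (n * n)) / 1) ℚ.< ((+ 12) / 1) ℚ.* α ℚ.* ((+ edges G) / 1) →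
       ∀ (t k : ℕ) → IsTau G t → IsNu G k → ((+ t) / 1) ℚ.< α ℚ.* ((+ k) / 1))
    ×
    (∀ (n : ℕ) (G : Graph n) → Tripartite G →
       -- e(G) > 33 n² / 112
       33 * (n * n) < 112 * edges G →
       -- τ(G) < (28/15) ν(G)
       ∀ (t k : ℕ) → IsTau G t → IsNu G k → 15 * t < 28 * k)
corollary3 = τ<αν , λ n G tripartite dense t k → qτ<pν G tripartite {p = 28} {q = 15} (33N<112e⇒[15+3·28]N<12·28e {n * n} {edges G} dense)
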